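{- Let $\alpha, \beta, \gamma$ be integers and $q(n) = \alpha n^2 + \beta n + \gamma$ for $n \geq 0$, and suppose $D_q(n) = 2^{\lceil \log_2 n \rceil}$ for all $n \geq 1$. Then for every integer $c$, the shifted sequence $q_c(n) = q(n + c)$ ($n \geq 0$) also satisfies $D_{q_c}(n) = 2^{\lceil \log_2 n \rceil}$ for all $n \geq 1$.
   Context: For an integer sequence $s = (s(i))_{i \geq 0}$ and an integer $n \geq 1$, the discriminator $D_s(n)$ is the least positive integer $m$ such that $s(0), \ldots, s(n-1)$ are pairwise incongruent modulo $m$. -}

module Defs where

open import Data.Nat as ℕ using (ℕ; zero; suc; _<_; _≤_)
open import Data.Integer as ℤ using (ℤ; +_; _-_)
open import Data.Integer.Divisibility using (_∣_)
open import Relation.Nullary using (¬_)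
open import Relation.Binary.PropositionalEquality using (_≡_)

PairwiseIncongruent : (ℕ → ℤ) → ℕ → ℕ → Set
PairwiseIncongruent s n m =
  ∀ i j → i < n → j < n → ¬ (i ≡ j) → ¬ ((+ m) ∣ (s i - s j))

IsDiscriminator : (ℕ → ℤ) → ℕ → ℕ → Set
IsDiscriminator s n m =
  1 ≤ m × PairwiseIncongruent s n m ×
  (∀ m′ → 1 ≤ m′ → m′ < m → ¬ PairwiseIncongruent s n m′)
  where open import Data.Product using (_×_)

quad : ℤ → ℤ → ℤ → ℤ → ℤ
quad α β γ x = α ℤ.* (x ℤ.* x) ℤ.+ β ℤ.* x ℤ.+ γ

-- For i ≠ j one has q(i) − q(j) = (i − j)(α(i + j) + β). The cases n = 2, 3 of the
-- hypothesis force α even and β odd, and the case n = p for an odd prime p forces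
-- p ∣ α ⇒ p ∣ β. These conditions also suffice for D_q(n) = 2^⌈log₂ n⌉: the factor
-- α(i + j) + β is odd, so 2^⌈log₂ n⌉ would have to divide |i − j| < n; and a smaller
-- modulus m = 2^a r (r odd) always admits a collision, either through an odd prime
-- common to r and α, or, when r is coprime to α, by solving a linear congruence modulo r
-- for i + j. Since q(n + c) is the quadratic with coefficients α, β + 2cα, q(c), and the
-- conditions survive this change of β, the shifted sequence satisfies them as well.

module Submission where

open import Data.Empty using (⊥; ⊥-elim)
open import Defs
open import Data.Integer.Base
  using (ℤ; +_; -[1+_]; _+_; _-_; _*_; -_; ∣_∣; 1ℤ; _%ℕ_; _/ℕ_)
open import Data.Integer.DivMod using (a≡a%ℕn+[a/ℕn]*n; n%ℕd<d)
open import Data.Integer.Divisibility.Signed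
  using ( _∣_; _∣?_; divides; ∣ᵤ⇒∣; ∣⇒∣ᵤ; ∣-refl; ∣m⇒∣-m; ∣n⇒∣m*n; ∣m⇒∣m*n
        ; ∣m∣n⇒∣m+n; ∣m∣n⇒∣m-n; ∣m+n∣m⇒∣n; *-monoʳ-∣)
open import Data.Integer.Properties
  using (abs-*; +-identityˡ; neg-distribˡ-*; pos-+; pos-*; m-n≡m⊖n; ∣⊖∣-≤; ∣i-j∣≡∣j-i∣)
open import Data.Integer.Tactic.RingSolver using (solve-∀)
open import Data.List.Base using ([]; _∷_)
open import Data.List.Relation.Unary.All using (_∷_)
open import Data.Nat.Base as ℕ
  using (ℕ; zero; suc; z≤n; s≤s; _≤_; _<_; _^_; NonZero; ⌊_/2⌋; ⌈_/2⌉)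
import Data.Nat.Properties as ℕ
import Data.Nat.Tactic.RingSolver as ℕ
open import Data.Nat.Divisibility as ℕ using (divides; ∣1⇒≡1; ∣-trans)
open import Data.Nat.Coprimality as Coprime
  using (Coprime; coprime?; coprime-divisor; coprime-Bézout; gcd≡1⇒coprime)
open import Data.Nat.GCD using (module Bézout; gcd; gcd[m,n]∣m; gcd[m,n]∣n; gcd[m,n]≢0)
open import Data.Nat.Induction using (<-wellFounded)
open import Data.Nat.ListAction using (product)
open import Data.Nat.Logarithm using (⌈log₂_⌉; ⌈log₂⌉-mono-≤; ⌈log₂2^n⌉≡n)
open import Data.Nat.Logarithm.Core using (⌈log2⌉)
open import Data.Nat.Primality
  using (Prime; prime[2]; prime⇒irreducible; prime⇒nonTrivial; euclidsLemma)
open import Data.Nat.Primality.Factorisation using (factorise)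
open import Data.Product using (_×_; _,_; proj₁; proj₂; ∃; ∃₂)
open import Function using (_∘_)
open import Data.Sum using (inj₁; inj₂; [_,_]′)
open import Induction.WellFounded using (Acc; acc)
open import Relation.Binary.PropositionalEquality
  using (_≡_; _≢_; refl; sym; trans; cong; cong₂; subst; ≢-sym; module ≡-Reasoning)
open import Relation.Nullary using (¬_; yes; no)

n≤⌈n/2⌉+⌈n/2⌉ : ∀ n → n ≤ ⌈ n /2⌉ ℕ.+ ⌈ n /2⌉
n≤⌈n/2⌉+⌈n/2⌉ n = begin
  n                   ≡⟨ ℕ.⌊n/2⌋+⌈n/2⌉≡n n ⟨
  ⌊ n /2⌋ ℕ.+ ⌈ n /2⌉ ≤⟨ ℕ.+-monoˡ-≤ ⌈ n /2⌉ (ℕ.⌊n/2⌋≤⌈n/2⌉ n) ⟩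
  ⌈ n /2⌉ ℕ.+ ⌈ n /2⌉ ∎
  where open ℕ.≤-Reasoning

⌊n/2⌋+⌊n/2⌋≤n : ∀ n → ⌊ n /2⌋ ℕ.+ ⌊ n /2⌋ ≤ n
⌊n/2⌋+⌊n/2⌋≤n n = begin
  ⌊ n /2⌋ ℕ.+ ⌊ n /2⌋ ≤⟨ ℕ.+-monoʳ-≤ ⌊ n /2⌋ (ℕ.⌊n/2⌋≤⌈n/2⌉ n) ⟩
  ⌊ n /2⌋ ℕ.+ ⌈ n /2⌉ ≡⟨ ℕ.⌊n/2⌋+⌈n/2⌉≡n n ⟩
  n                   ∎
  where open ℕ.≤-Reasoning

sum-of-distinct-below : ∀ {t n} → t ℕ.+ 4 ≤ 2 ℕ.* n →
  ∃₂ λ i j → i < n × j < i × i ℕ.+ j ≡ suc t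
sum-of-distinct-below {t} {n} bound =
  suc ⌈ t /2⌉ , ⌊ t /2⌋ , i<n , s≤s (ℕ.⌊n/2⌋≤⌈n/2⌉ t) ,
  cong suc (trans (ℕ.+-comm ⌈ t /2⌉ ⌊ t /2⌋) (ℕ.⌊n/2⌋+⌈n/2⌉≡n t))
  where
  open ℕ.≤-Reasoning
  c = ⌈ t /2⌉
  i<n : suc c < n
  i<n = ℕ.*-cancelˡ-< 2 (suc c) n (begin-strict
    2 ℕ.* suc c       ≡⟨ ℕ.*-suc 2 c ⟩
    2 ℕ.+ 2 ℕ.* c     ≡⟨ cong (λ x → 2 ℕ.+ (c ℕ.+ x)) (ℕ.+-identityʳ c) ⟩
    2 ℕ.+ (c ℕ.+ c)   ≤⟨ ℕ.+-monoʳ-≤ 2 (⌊n/2⌋+⌊n/2⌋≤n (suc t)) ⟩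
    3 ℕ.+ t           ≡⟨ ℕ.+-comm 3 t ⟩
    t ℕ.+ 3           <⟨ ℕ.+-monoʳ-< t (ℕ.n<1+n 3) ⟩
    t ℕ.+ 4           ≤⟨ bound ⟩
    2 ℕ.* n           ∎)

2*T*r+3≤2*n⇒r+2*T≤n : ∀ {T r n} → 1 ≤ T → 2 ≤ r →
  2 ℕ.* T ℕ.* r ℕ.+ 3 ≤ 2 ℕ.* n → r ℕ.+ 2 ℕ.* T ≤ n
2*T*r+3≤2*n⇒r+2*T≤n {suc _} {suc zero} _ (s≤s ())
2*T*r+3≤2*n⇒r+2*T≤n {suc t} {suc (suc s)} {n} _ _ bound =
  ℕ.≤-pred (ℕ.*-cancelˡ-< 2 _ (suc n) (begin-strict
  2 ℕ.* (r ℕ.+ 2 ℕ.* T)                       ≤⟨ ℕ.m≤m+n _ (2 ℕ.* (t ℕ.* s)) ⟩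
  2 ℕ.* (r ℕ.+ 2 ℕ.* T) ℕ.+ 2 ℕ.* (t ℕ.* s)   ≡⟨ identity t s ⟩
  suc (2 ℕ.* T ℕ.* r ℕ.+ 3)                   ≤⟨ s≤s bound ⟩
  suc (2 ℕ.* n)                               <⟨ ℕ.n<1+n _ ⟩
  2 ℕ.+ 2 ℕ.* n                               ≡⟨ ℕ.*-suc 2 n ⟨
  2 ℕ.* suc n                                 ∎))
  where
  open ℕ.≤-Reasoning
  T = suc t
  r = suc (suc s)
  identity : ∀ t s → 2 ℕ.* ((2 ℕ.+ s) ℕ.+ 2 ℕ.* (1 ℕ.+ t)) ℕ.+ 2 ℕ.* (t ℕ.* s)
                   ≡ 1 ℕ.+ (2 ℕ.* (1 ℕ.+ t) ℕ.* (2 ℕ.+ s) ℕ.+ 3)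
  identity = ℕ.solve-∀

n≤2^⌈log₂n⌉ : ∀ n → n ≤ 2 ^ ⌈log₂ n ⌉
n≤2^⌈log₂n⌉ n = go n (<-wellFounded n)
  where
  go : ∀ n (rec : Acc _<_ n) → n ≤ 2 ^ ⌈log2⌉ n rec
  go 0 _ = z≤n
  go 1 _ = s≤s z≤n
  go n@(suc (suc k)) (acc rs) = begin
    n                       ≤⟨ n≤⌈n/2⌉+⌈n/2⌉ n ⟩
    ⌈ n /2⌉ ℕ.+ ⌈ n /2⌉     ≤⟨ ℕ.+-mono-≤ ih ih ⟩
    2^e ℕ.+ 2^e             ≡⟨ cong (2^e ℕ.+_) (ℕ.+-identityʳ 2^e) ⟨
    2 ℕ.* 2^e               ∎
    where
    open ℕ.≤-Reasoning
    2^e = 2 ^ ⌈log2⌉ ⌈ n /2⌉ (rs (ℕ.⌈n/2⌉<n k))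
    ih = go ⌈ n /2⌉ (rs (ℕ.⌈n/2⌉<n k))

⌈log₂⌉-least : ∀ {n k} → n ≤ 2 ^ k → ⌈log₂ n ⌉ ≤ k
⌈log₂⌉-least {k = k} n≤2^k =
  ℕ.≤-trans (⌈log₂⌉-mono-≤ n≤2^k) (ℕ.≤-reflexive (⌈log₂2^n⌉≡n k))

<⌈log₂⌉⇒2^<n : ∀ {n k} → k < ⌈log₂ n ⌉ → 2 ^ k < n
<⌈log₂⌉⇒2^<n k<e = ℕ.≰⇒> (λ n≤2^k → ℕ.<⇒≱ k<e (⌈log₂⌉-least n≤2^k))

odd⇒<2^⌈log₂⌉ : ∀ {n} → 1 < n → ¬ 2 ℕ.∣ n → n < 2 ^ ⌈log₂ n ⌉
odd⇒<2^⌈log₂⌉ {n} 1<n odd with ⌈log₂ n ⌉ | n≤2^⌈log₂n⌉ n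
... | zero  | n≤1 = ⊥-elim (ℕ.<⇒≱ 1<n n≤1)
... | suc k | n≤2^e with ℕ.m≤n⇒m<n∨m≡n n≤2^e
...   | inj₁ n<2^e = n<2^e
...   | inj₂ refl  = ⊥-elim (odd (ℕ.∣m⇒∣m*n (2 ^ k) (ℕ.∣-refl {2})))

<2^⌈log₂⌉⇒+3≤2* : ∀ {m n} → 1 ≤ m → m < 2 ^ ⌈log₂ n ⌉ → m ℕ.+ 3 ≤ 2 ℕ.* n
<2^⌈log₂⌉⇒+3≤2* {m} {n} 1≤m m<2^e with ⌈log₂ n ⌉ in e≡
... | zero  = ⊥-elim (ℕ.<⇒≱ m<2^e 1≤m)
... | suc k = begin
  m ℕ.+ 3           ≡⟨ ℕ.+-comm m 3 ⟩
  2 ℕ.+ suc m       ≤⟨ ℕ.+-monoʳ-≤ 2 m<2^e ⟩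
  2 ℕ.+ 2 ℕ.* 2 ^ k ≡⟨ ℕ.*-suc 2 (2 ^ k) ⟨
  2 ℕ.* suc (2 ^ k) ≤⟨ ℕ.*-monoʳ-≤ 2 (<⌈log₂⌉⇒2^<n {n} (ℕ.≤-reflexive (sym e≡))) ⟩
  2 ℕ.* n           ∎
  where open ℕ.≤-Reasoning

coprime-*ʳ : ∀ {m n o} → Coprime m n → Coprime m o → Coprime m (n ℕ.* o)
coprime-*ʳ m⊥n m⊥o (d∣m , d∣n*o) =
  m⊥o (d∣m , coprime-divisor (λ (e∣d , e∣n) → m⊥n (∣-trans e∣d d∣m , e∣n)) d∣n*o)

coprime-^ʳ : ∀ {m n} → Coprime m n → ∀ e → Coprime m (n ^ e)
coprime-^ʳ m⊥n zero    (_ , d∣1) = ∣1⇒≡1 d∣1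
coprime-^ʳ m⊥n (suc e) = coprime-*ʳ m⊥n (coprime-^ʳ m⊥n e)

odd⇒coprime-2 : ∀ {n} → ¬ 2 ℕ.∣ n → Coprime n 2
odd⇒coprime-2 odd (d∣n , d∣2) with prime⇒irreducible prime[2] d∣2
... | inj₁ d≡1 = d≡1
... | inj₂ refl = ⊥-elim (odd d∣n)

odd-part : ∀ m .{{_ : NonZero m}} → ∃₂ λ a r → m ≡ 2 ^ a ℕ.* r × ¬ 2 ℕ.∣ r
odd-part m = go m (<-wellFounded m)
  where
  go : ∀ m .{{_ : NonZero m}} → Acc _<_ m → ∃₂ λ a r → m ≡ 2 ^ a ℕ.* r × ¬ 2 ℕ.∣ r
  go m (acc rs) with 2 ℕ.∣? m
  ... | no odd = 0 , m , sym (ℕ.+-identityʳ m) , odd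
  ... | yes (divides q refl) with go q {{q≢0}} (rs (ℕ.m<m*n q 2 {{q≢0}} (s≤s (s≤s z≤n))))
    where q≢0 = ℕ.m*n≢0⇒m≢0 q
  ...   | a , r , refl , odd = suc a , r , eq , odd
    where
    eq : 2 ^ a ℕ.* r ℕ.* 2 ≡ 2 ℕ.* 2 ^ a ℕ.* r
    eq = trans (ℕ.*-comm (2 ^ a ℕ.* r) 2) (sym (ℕ.*-assoc 2 (2 ^ a) r))

prime-divisor : ∀ {n} → 1 < n → ∃ λ p → Prime p × p ℕ.∣ n
prime-divisor {n@(suc _)} 1<n with factorise n
... | record { factors = [] ; isFactorisation = n≡1 } = ⊥-elim (ℕ.<⇒≢ 1<n (sym n≡1))
... | record { factors = p ∷ ps ; isFactorisation = n≡p*ps ; factorsPrime = p-prime ∷ _ } =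
  p , p-prime , divides (product ps) (trans n≡p*ps (ℕ.*-comm p (product ps)))

¬coprime⇒common-prime : ∀ {m n} .{{_ : NonZero m}} → ¬ Coprime m n →
  ∃ λ p → Prime p × p ℕ.∣ m × p ℕ.∣ n
¬coprime⇒common-prime {m} {n} ¬m⊥n with prime-divisor {gcd m n} 1<gcd
  where
  1<gcd : 1 < gcd m n
  1<gcd = ℕ.≤∧≢⇒< (ℕ.n≢0⇒n>0 (gcd[m,n]≢0 m n (inj₁ (ℕ.≢-nonZero⁻¹ m))))
                  (¬m⊥n ∘ gcd≡1⇒coprime ∘ sym)
... | p , p-prime , p∣gcd =
  p , p-prime , ∣-trans p∣gcd (gcd[m,n]∣m m n) , ∣-trans p∣gcd (gcd[m,n]∣n m n)

-- Parity and linear congruences over ℤ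

odd⇒2∣[z-1] : ∀ {z} → ¬ + 2 ∣ z → + 2 ∣ z - 1ℤ
odd⇒2∣[z-1] {z} odd with z %ℕ 2 | n%ℕd<d z 2 | a≡a%ℕn+[a/ℕn]*n z 2
... | 0           | _             | z≡ = ⊥-elim (odd (divides (z /ℕ 2) (trans z≡ (+-identityˡ _))))
... | 1           | _             | z≡ = divides (z /ℕ 2) (begin
  z - 1ℤ                      ≡⟨ cong (_- 1ℤ) z≡ ⟩
  1ℤ + z /ℕ 2 * + 2 - 1ℤ      ≡⟨ cancel (z /ℕ 2) ⟩
  z /ℕ 2 * + 2                ∎)
  where
  open ≡-Reasoning
  cancel : ∀ q → 1ℤ + q * + 2 - 1ℤ ≡ q * + 2
  cancel = solve-∀
... | suc (suc _) | s≤s (s≤s ()) | _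

pos-1+*≡* : ∀ {a b c d} → 1 ℕ.+ a ℕ.* b ≡ c ℕ.* d → 1ℤ + + a * + b ≡ + c * + d
pos-1+*≡* {a} {b} {c} {d} eq = begin
  1ℤ + + a * + b    ≡⟨ cong (λ z → 1ℤ + z) (pos-* a b) ⟨
  1ℤ + + (a ℕ.* b)  ≡⟨ pos-+ 1 (a ℕ.* b) ⟨
  + (1 ℕ.+ a ℕ.* b) ≡⟨ cong +_ eq ⟩
  + (c ℕ.* d)       ≡⟨ pos-* c d ⟩
  + c * + d         ∎
  where open ≡-Reasoning

coprime⇒inverse-pos : ∀ {r l} → Coprime r l → ∃ λ u → + r ∣ + l * u - 1ℤ
coprime⇒inverse-pos {r} {l} r⊥l with coprime-Bézout r⊥l
... | Bézout.+- x y eq = - + y , divides (- + x) (begin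
  + l * - + y - 1ℤ      ≡⟨ rearrange (+ l) (+ y) ⟩
  - (1ℤ + + y * + l)    ≡⟨ cong -_ (pos-1+*≡* {y} {l} {x} {r} eq) ⟩
  - (+ x * + r)         ≡⟨ neg-distribˡ-* (+ x) (+ r) ⟩
  - + x * + r           ∎)
  where
  open ≡-Reasoning
  rearrange : ∀ l y → l * - y - 1ℤ ≡ - (1ℤ + y * l)
  rearrange = solve-∀
... | Bézout.-+ x y eq = + y , divides (+ x) (begin
  + l * + y - 1ℤ        ≡⟨ rearrange (+ l) (+ y) ⟩
  - 1ℤ + + y * + l      ≡⟨ cong (λ z → - 1ℤ + z) (pos-1+*≡* {x} {r} {y} {l} eq) ⟨
  - 1ℤ + (1ℤ + + x * + r) ≡⟨ cancel (+ x * + r) ⟩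
  + x * + r             ∎)
  where
  open ≡-Reasoning
  rearrange : ∀ l y → l * y - 1ℤ ≡ - 1ℤ + y * l
  rearrange = solve-∀
  cancel : ∀ z → - 1ℤ + (1ℤ + z) ≡ z
  cancel = solve-∀

coprime⇒inverse : ∀ {r} L → Coprime r ∣ L ∣ → ∃ λ u → + r ∣ L * u - 1ℤ
coprime⇒inverse (+ l)    r⊥l = coprime⇒inverse-pos r⊥l
coprime⇒inverse {r} -[1+ l ] r⊥l with coprime⇒inverse-pos r⊥l
... | u , r∣lu-1 = - u , subst (λ z → + r ∣ z - 1ℤ) (neg-*-neg (+ suc l) u) r∣lu-1
  where
  neg-*-neg : ∀ x y → x * y ≡ - x * - y
  neg-*-neg = solve-∀

reduce-mod : ∀ r .{{_ : NonZero r}} L K x → + r ∣ L * x + K →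
             ∃ λ y → y < r × + r ∣ L * + y + K
reduce-mod r L K x r∣Lx+K =
  x %ℕ r , n%ℕd<d x r ,
  subst (+ r ∣_) (sym (shift L K (+ (x %ℕ r)) (x /ℕ r) (+ r) x (a≡a%ℕn+[a/ℕn]*n x r)))
        (∣m∣n⇒∣m-n r∣Lx+K (∣n⇒∣m*n (L * (x /ℕ r)) ∣-refl))
  where
  shift : ∀ L K y q r x → x ≡ y + q * r → L * y + K ≡ L * x + K - L * q * r
  shift L K y q r x refl = expand L K y q r
    where
    expand : ∀ L K y q r → L * y + K ≡ L * (y + q * r) + K - L * q * r
    expand = solve-∀

linear-congruence : ∀ r .{{_ : NonZero r}} L K → Coprime r ∣ L ∣ →
                    ∃ λ y → y < r × + r ∣ L * + y + K
linear-congruence r L K r⊥L with coprime⇒inverse L r⊥L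
... | u , r∣Lu-1 = reduce-mod r L K (- (u * K))
  (subst (+ r ∣_) (sym (solution L K u)) (∣m⇒∣-m (∣m⇒∣m*n K r∣Lu-1)))
  where
  solution : ∀ L K u → L * - (u * K) + K ≡ - ((L * u - 1ℤ) * K)
  solution = solve-∀

quad-difference : ∀ α β γ x y → quad α β γ x - quad α β γ y ≡ (x - y) * (α * (x + y) + β)
quad-difference = expand
  where
  expand : ∀ α β γ x y → (α * (x * x) + β * x + γ) - (α * (y * y) + β * y + γ)
                       ≡ (x - y) * (α * (x + y) + β)
  expand = solve-∀

quad-shift : ∀ α β γ c x → quad α β γ (x + c) ≡ quad α (α * (c + c) + β) (quad α β γ c) x
quad-shift = expand
  where
  expand : ∀ α β γ c x → α * ((x + c) * (x + c)) + β * (x + c) + γ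
                       ≡ α * (x * x) + (α * (c + c) + β) * x + (α * (c * c) + β * c + γ)
  expand = solve-∀

∣[+m]-[+n]∣≡∣m-n∣ : ∀ m n → ∣ + m - + n ∣ ≡ ℕ.∣ m - n ∣
∣[+m]-[+n]∣≡∣m-n∣ m n = [ ordered , flipped ]′ (ℕ.≤-total m n)
  where
  ordered : ∀ {m n} → m ≤ n → ∣ + m - + n ∣ ≡ ℕ.∣ m - n ∣
  ordered {m} {n} m≤n = trans (cong ∣_∣ (m-n≡m⊖n m n))
    (trans (∣⊖∣-≤ m≤n) (sym (ℕ.m≤n⇒∣m-n∣≡n∸m m≤n)))
  flipped : n ≤ m → ∣ + m - + n ∣ ≡ ℕ.∣ m - n ∣
  flipped n≤m = trans (∣i-j∣≡∣j-i∣ (+ m) (+ n)) (trans (ordered n≤m) (ℕ.∣-∣-comm n m))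

∣quad[i]-quad[j]∣ : ∀ α β γ i j →
  ∣ quad α β γ (+ i) - quad α β γ (+ j) ∣ ≡ ℕ.∣ i - j ∣ ℕ.* ∣ α * (+ i + + j) + β ∣
∣quad[i]-quad[j]∣ α β γ i j = begin
  ∣ quad α β γ (+ i) - quad α β γ (+ j) ∣ ≡⟨ cong ∣_∣ (quad-difference α β γ (+ i) (+ j)) ⟩
  ∣ (+ i - + j) * W ∣                     ≡⟨ abs-* (+ i - + j) W ⟩
  ∣ + i - + j ∣ ℕ.* ∣ W ∣                 ≡⟨ cong (ℕ._* ∣ W ∣) (∣[+m]-[+n]∣≡∣m-n∣ i j) ⟩
  ℕ.∣ i - j ∣ ℕ.* ∣ W ∣                   ∎
  where
  open ≡-Reasoning
  W = α * (+ i + + j) + β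

∤-distance : ∀ {i j n m} → i < n → j < n → i ≢ j → n ≤ m → ¬ m ℕ.∣ ℕ.∣ i - j ∣
∤-distance {i} {j} i<n j<n i≢j n≤m =
  ℕ.>⇒∤ {{ℕ.≢-nonZero (λ ∣i-j∣≡0 → i≢j (ℕ.∣m-n∣≡0⇒m≡n ∣i-j∣≡0))}}
        (ℕ.<-≤-trans (ℕ.≤-<-trans (ℕ.∣m-n∣≤m⊔n i j) (ℕ.⊔-lub i<n j<n)) n≤m)

incongruent⇒∤ : ∀ {s n m i j} → PairwiseIncongruent s n m →
  i < n → j < n → i ≢ j → ¬ + m ∣ s i - s j
incongruent⇒∤ {i = i} {j} incongruent i<n j<n i≢j = incongruent i j i<n j<n i≢j ∘ ∣⇒∣ᵤ

PairwiseIncongruent-cong : ∀ {s t n m} → (∀ k → s k ≡ t k) →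
  PairwiseIncongruent s n m → PairwiseIncongruent t n m
PairwiseIncongruent-cong {m = m} s≗t incongruent i j i<n j<n i≢j m∣ =
  incongruent i j i<n j<n i≢j
    (subst (λ z → m ℕ.∣ ∣ z ∣) (sym (cong₂ _-_ (s≗t i) (s≗t j))) m∣)

IsDiscriminator-cong : ∀ {s t n m} → (∀ k → s k ≡ t k) →
  IsDiscriminator s n m → IsDiscriminator t n m
IsDiscriminator-cong s≗t (1≤m , incongruent , least) =
  1≤m , PairwiseIncongruent-cong s≗t incongruent ,
  λ m′ 1≤m′ m′<m → least m′ 1≤m′ m′<m ∘ PairwiseIncongruent-cong (sym ∘ s≗t)

HasPowerOfTwoDiscriminator : (ℕ → ℤ) → Set
HasPowerOfTwoDiscriminator s = ∀ n → 1 ≤ n → IsDiscriminator s n (2 ^ ⌈log₂ n ⌉)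

-- Admissible coefficients

record Admissible (α β : ℤ) : Set where
  field
    even-α          : + 2 ∣ α
    odd-β           : ¬ + 2 ∣ β
    odd-prime-∣α⇒∣β : ∀ {p} → Prime p → ¬ 2 ℕ.∣ p → + p ∣ α → + p ∣ β

quad-incongruent-mod-prime : ∀ {α β γ p} → Prime p → + p ∣ α → ¬ + p ∣ β →
  PairwiseIncongruent (λ k → quad α β γ (+ k)) p p
quad-incongruent-mod-prime {α} {β} {γ} {p} p-prime p∣α p∤β i j i<p j<p i≢j p∣q[i]-q[j]
  with euclidsLemma _ _ p-prime (subst (p ℕ.∣_) (∣quad[i]-quad[j]∣ α β γ i j) p∣q[i]-q[j])
... | inj₁ p∣∣i-j∣ = ∤-distance i<p j<p i≢j ℕ.≤-refl p∣∣i-j∣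
... | inj₂ p∣W     = p∤β (∣m+n∣m⇒∣n (∣ᵤ⇒∣ p∣W) (∣m⇒∣m*n (+ i + + j) p∣α))

power-of-two-discriminator⇒admissible : ∀ {α β γ} →
  HasPowerOfTwoDiscriminator (λ k → quad α β γ (+ k)) → Admissible α β
power-of-two-discriminator⇒admissible {α} {β} {γ} disc = record
  { even-α = subst (+ 2 ∣_) (difference-of-odds α β)
               (∣m∣n⇒∣m-n (odd⇒2∣[z-1] odd-α+β) (odd⇒2∣[z-1] odd-β))
  ; odd-β  = odd-β
  ; odd-prime-∣α⇒∣β = odd-prime-∣α⇒∣β
  }
  where
  q : ℕ → ℤ
  q k = quad α β γ (+ k)

  incongruent : ∀ n → 1 ≤ n → PairwiseIncongruent q n (2 ^ ⌈log₂ n ⌉)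
  incongruent n 1≤n = proj₁ (proj₂ (disc n 1≤n))

  least : ∀ n → 1 ≤ n → ∀ m → 1 ≤ m → m < 2 ^ ⌈log₂ n ⌉ → ¬ PairwiseIncongruent q n m
  least n 1≤n = proj₂ (proj₂ (disc n 1≤n))

  q[1]-q[0] : ∀ α β γ → (α * (+ 1 * + 1) + β * + 1 + γ) - (α * (+ 0 * + 0) + β * + 0 + γ)
                       ≡ α + β
  q[1]-q[0] = solve-∀

  q[2]-q[0] : ∀ α β γ → (α * (+ 2 * + 2) + β * + 2 + γ) - (α * (+ 0 * + 0) + β * + 0 + γ)
                       ≡ + 2 * (+ 2 * α + β)
  q[2]-q[0] = solve-∀

  difference-of-odds : ∀ α β → α + β - 1ℤ - (β - 1ℤ) ≡ α
  difference-of-odds = solve-∀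

  odd-α+β : ¬ + 2 ∣ α + β
  odd-α+β 2∣α+β =
    incongruent⇒∤ {s = q} {i = 1} {0} (incongruent 2 (s≤s z≤n)) (s≤s (s≤s z≤n)) (s≤s z≤n) (λ ())
      (subst (+ 2 ∣_) (sym (q[1]-q[0] α β γ)) 2∣α+β)

  odd-β : ¬ + 2 ∣ β
  odd-β 2∣β =
    incongruent⇒∤ {s = q} {i = 2} {0} (incongruent 3 (s≤s z≤n)) (s≤s (s≤s (s≤s z≤n))) (s≤s z≤n) (λ ())
      (subst (+ 4 ∣_) (sym (q[2]-q[0] α β γ))
        (*-monoʳ-∣ (+ 2) (∣m∣n⇒∣m+n (∣m⇒∣m*n α ∣-refl) 2∣β)))

  odd-prime-∣α⇒∣β : ∀ {p} → Prime p → ¬ 2 ℕ.∣ p → + p ∣ α → + p ∣ β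
  odd-prime-∣α⇒∣β {p} p-prime odd p∣α with + p ∣? β
  ... | yes p∣β = p∣β
  ... | no  p∤β = ⊥-elim (least p 1≤p p 1≤p (odd⇒<2^⌈log₂⌉ 1<p odd)
                            (quad-incongruent-mod-prime p-prime p∣α p∤β))
    where
    1<p = ℕ.nonTrivial⇒n>1 p {{prime⇒nonTrivial p-prime}}
    1≤p = ℕ.<⇒≤ 1<p

odd-linear : ∀ {α β} → Admissible α β → ∀ x → ¬ + 2 ∣ α * x + β
odd-linear adm x 2∣αx+β = odd-β (∣m+n∣m⇒∣n 2∣αx+β (∣m⇒∣m*n x even-α))
  where open Admissible adm

admissible-shift : ∀ {α β} → Admissible α β → ∀ c → Admissible α (α * (c + c) + β)
admissible-shift adm c = record
  { even-α = even-α
  ; odd-β  = odd-linear adm (c + c)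
  ; odd-prime-∣α⇒∣β = λ p-prime odd p∣α →
      ∣m∣n⇒∣m+n (∣m⇒∣m*n (c + c) p∣α) (odd-prime-∣α⇒∣β p-prime odd p∣α)
  }
  where open Admissible adm

-- Sufficiency of admissibility

admissible⇒incongruent : ∀ {α β} → Admissible α β → ∀ γ n →
  PairwiseIncongruent (λ k → quad α β γ (+ k)) n (2 ^ ⌈log₂ n ⌉)
admissible⇒incongruent {α} {β} adm γ n i j i<n j<n i≢j 2^e∣ =
  ∤-distance i<n j<n i≢j (n≤2^⌈log₂n⌉ n)
    (coprime-divisor 2^e⊥W (subst (2 ^ ⌈log₂ n ⌉ ℕ.∣_) factorised 2^e∣))
  where
  W = α * (+ i + + j) + β
  2^e⊥W : Coprime (2 ^ ⌈log₂ n ⌉) ∣ W ∣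
  2^e⊥W = Coprime.sym
    (coprime-^ʳ (odd⇒coprime-2 (odd-linear adm (+ i + + j) ∘ ∣ᵤ⇒∣)) ⌈log₂ n ⌉)
  factorised : ∣ quad α β γ (+ i) - quad α β γ (+ j) ∣ ≡ ∣ W ∣ ℕ.* ℕ.∣ i - j ∣
  factorised = trans (∣quad[i]-quad[j]∣ α β γ i j) (ℕ.*-comm ℕ.∣ i - j ∣ ∣ W ∣)

module Collisions {α β γ : ℤ} (adm : Admissible α β) {n m : ℕ} .{{_ : NonZero m}}
                  (incongruent : PairwiseIncongruent (λ k → quad α β γ (+ k)) n m) where
  open Admissible adm

  no-collision : ∀ {i j} → i < n → j < n → i ≢ j →
                 ¬ m ℕ.∣ ℕ.∣ i - j ∣ ℕ.* ∣ α * (+ i + + j) + β ∣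
  no-collision {i} {j} i<n j<n i≢j =
    incongruent i j i<n j<n i≢j ∘ subst (m ℕ.∣_) (sym (∣quad[i]-quad[j]∣ α β γ i j))

  no-collision-at : ∀ {i j r} → i < n → j < n → m ≡ ℕ.∣ i - j ∣ ℕ.* r →
                    ¬ r ℕ.∣ ∣ α * (+ i + + j) + β ∣
  no-collision-at {i} {j} {r} i<n j<n m≡ r∣W =
    no-collision i<n j<n i≢j (subst (ℕ._∣ _) (sym m≡) (ℕ.*-monoʳ-∣ ℕ.∣ i - j ∣ r∣W))
    where
    i≢j : i ≢ j
    i≢j refl = ℕ.≢-nonZero⁻¹ m (trans m≡ (cong (ℕ._* r) (ℕ.∣n-n∣≡0 i)))

  n≤m : n ≤ m
  n≤m = ℕ.≮⇒≥ λ m<n → no-collision-at {m} {0} {1} m<n (ℕ.≤-<-trans z≤n m<n)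
    (sym (trans (ℕ.*-identityʳ _) (ℕ.∣-∣-identityʳ m))) (ℕ.1∣ _)

  ∤-common-odd-prime : m < 2 ℕ.* n → ∀ {p} → Prime p → ¬ 2 ℕ.∣ p → p ℕ.∣ m → ¬ + p ∣ α
  ∤-common-odd-prime m<2n {p} p-prime odd (divides t m≡t*p) p∣α =
    no-collision-at {t} {0} t<n (ℕ.≤-<-trans z≤n t<n)
      (trans m≡t*p (cong (ℕ._* p) (sym (ℕ.∣-∣-identityʳ t))))
      (∣⇒∣ᵤ (∣m∣n⇒∣m+n (∣m⇒∣m*n (+ t + + 0) p∣α) (odd-prime-∣α⇒∣β p-prime odd p∣α)))
    where
    open ℕ.≤-Reasoning
    t<n : t < n
    t<n = ℕ.*-cancelˡ-< 2 t n (begin-strict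
      2 ℕ.* t  ≤⟨ ℕ.*-monoˡ-≤ t (ℕ.nonTrivial⇒n>1 p {{prime⇒nonTrivial p-prime}}) ⟩
      p ℕ.* t  ≡⟨ ℕ.*-comm p t ⟩
      t ℕ.* p  ≡⟨ m≡t*p ⟨
      m        <⟨ m<2n ⟩
      2 ℕ.* n  ∎)

  -- A solution i + j ∈ [1, m] of m ∣ α(i + j) + β splits into distinct i, j < n
  -- because m ≤ 2n − 3.
  ¬coprime-to-α : m ℕ.+ 3 ≤ 2 ℕ.* n → ¬ Coprime m ∣ α ∣
  ¬coprime-to-α bound m⊥α with linear-congruence m α (α + β) m⊥α
  ... | y , y<m , m∣ with sum-of-distinct-below {y} {n} y+4≤2n
    where
    open ℕ.≤-Reasoning
    y+4≤2n : y ℕ.+ 4 ≤ 2 ℕ.* n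
    y+4≤2n = begin
      y ℕ.+ 4      ≡⟨ ℕ.+-suc y 3 ⟩
      suc y ℕ.+ 3  ≤⟨ ℕ.+-monoˡ-≤ 3 y<m ⟩
      m ℕ.+ 3      ≤⟨ bound ⟩
      2 ℕ.* n      ∎
  ... | i , j , i<n , j<i , i+j≡1+y =
    no-collision i<n (ℕ.<-trans j<i i<n) (≢-sym (ℕ.<⇒≢ j<i))
      (ℕ.∣n⇒∣m*n ℕ.∣ i - j ∣ (∣⇒∣ᵤ (subst (+ m ∣_) W≡ m∣)))
    where
    open ≡-Reasoning
    W≡ : α * + y + (α + β) ≡ α * (+ i + + j) + β
    W≡ = begin
      α * + y + (α + β)       ≡⟨ rearrange α (+ y) β ⟩
      α * (+ 1 + + y) + β     ≡⟨ cong (λ z → α * z + β) (pos-+ 1 y) ⟨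
      α * + suc y + β         ≡⟨ cong (λ z → α * + z + β) i+j≡1+y ⟨
      α * + (i ℕ.+ j) + β     ≡⟨ cong (λ z → α * z + β) (pos-+ i j) ⟩
      α * (+ i + + j) + β     ∎
      where
      rearrange : ∀ α y β → α * y + (α + β) ≡ α * (+ 1 + y) + β
      rearrange = solve-∀

  -- The pair (y + D, y) has distance D and sum 2y + D.
  ¬coprime-to-2α : ∀ {D r} .{{_ : NonZero r}} → m ≡ D ℕ.* r → r ℕ.+ D ≤ n →
                   ¬ Coprime r ∣ + 2 * α ∣
  ¬coprime-to-2α {D} {r} m≡D*r r+D≤n r⊥2α
    with linear-congruence r (+ 2 * α) (α * + D + β) r⊥2α
  ... | y , y<r , r∣ =
    no-collision-at {y ℕ.+ D} {y} y+D<n (ℕ.≤-<-trans (ℕ.m≤m+n y D) y+D<n)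
      (trans m≡D*r (cong (ℕ._* r) (sym distance)))
      (∣⇒∣ᵤ (subst (+ r ∣_) W≡ r∣))
    where
    y+D<n : y ℕ.+ D < n
    y+D<n = ℕ.<-≤-trans (ℕ.+-monoˡ-< D y<r) r+D≤n
    distance : ℕ.∣ y ℕ.+ D - y ∣ ≡ D
    distance = trans (ℕ.m≤n⇒∣n-m∣≡n∸m (ℕ.m≤m+n y D)) (ℕ.m+n∸m≡n y D)
    W≡ : + 2 * α * + y + (α * + D + β) ≡ α * (+ (y ℕ.+ D) + + y) + β
    W≡ = trans (rearrange α (+ y) (+ D) β) (cong (λ z → α * (z + + y) + β) (sym (pos-+ y D)))
      where
      rearrange : ∀ α y D β → + 2 * α * y + (α * D + β) ≡ α * (y + D + y) + β
      rearrange = solve-∀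

admissible⇒least : ∀ {α β} → Admissible α β → ∀ γ {n} m → 1 ≤ m → m < 2 ^ ⌈log₂ n ⌉ →
  ¬ PairwiseIncongruent (λ k → quad α β γ (+ k)) n m
admissible⇒least {α} adm γ {n} m 1≤m m<2^e incongruent = refute (odd-part m)
  where
  instance
    m≢0 : NonZero m
    m≢0 = ℕ.>-nonZero 1≤m
  open Collisions adm incongruent

  bound : m ℕ.+ 3 ≤ 2 ℕ.* n
  bound = <2^⌈log₂⌉⇒+3≤2* {m} {n} 1≤m m<2^e

  coprime-odd-part : ∀ a r → m ≡ 2 ^ a ℕ.* r → ¬ 2 ℕ.∣ r → ¬ Coprime r ∣ α ∣
  coprime-odd-part zero r m≡r _ =
    ¬coprime-to-α bound ∘ subst (λ k → Coprime k ∣ α ∣) (sym (trans m≡r (ℕ.*-identityˡ r)))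
  coprime-odd-part (suc a) 0 m≡0 _ _ = ℕ.≢-nonZero⁻¹ m (trans m≡0 (ℕ.*-zeroʳ (2 ^ suc a)))
  -- m would be a power of two with n ≤ m < 2^⌈log₂ n⌉.
  coprime-odd-part (suc a) 1 m≡2^a _ _ = ℕ.<⇒≱ m<2^e (begin
    2 ^ ⌈log₂ n ⌉  ≤⟨ ℕ.^-monoʳ-≤ 2 (⌈log₂⌉-least {n} {suc a} n≤2^a) ⟩
    2 ^ suc a      ≡⟨ m≡2^a′ ⟨
    m              ∎)
    where
    open ℕ.≤-Reasoning
    m≡2^a′ = trans m≡2^a (ℕ.*-identityʳ _)
    n≤2^a = ℕ.≤-trans n≤m (ℕ.≤-reflexive m≡2^a′)
  coprime-odd-part (suc a) r@(suc (suc _)) m≡ odd-r r⊥α =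
    ¬coprime-to-2α m≡ r+2^a≤n (subst (Coprime r) (sym (abs-* (+ 2) α)) r⊥2α)
    where
    r+2^a≤n = 2*T*r+3≤2*n⇒r+2*T≤n (ℕ.m^n>0 2 a) (s≤s (s≤s z≤n))
                (subst (λ k → k ℕ.+ 3 ≤ 2 ℕ.* n) m≡ bound)
    r⊥2α = coprime-*ʳ (odd⇒coprime-2 odd-r) r⊥α

  refute : (∃₂ λ a r → m ≡ 2 ^ a ℕ.* r × ¬ 2 ℕ.∣ r) → ⊥
  refute (a , r , m≡2^a*r , odd-r) with coprime? r ∣ α ∣
  ... | yes r⊥α = coprime-odd-part a r m≡2^a*r odd-r r⊥α
  ... | no ¬r⊥α with ¬coprime⇒common-prime {{r≢0}} ¬r⊥α
    where
    r≢0 : NonZero r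
    r≢0 = ℕ.m*n≢0⇒n≢0 (2 ^ a) {{subst NonZero m≡2^a*r m≢0}}
  ...   | p , p-prime , p∣r , p∣α =
    ∤-common-odd-prime (ℕ.<-≤-trans (ℕ.m<m+n m (s≤s z≤n)) bound) p-prime
      (odd-r ∘ λ 2∣p → ∣-trans 2∣p p∣r)
      (subst (p ℕ.∣_) (sym m≡2^a*r) (ℕ.∣n⇒∣m*n (2 ^ a) p∣r))
      (∣ᵤ⇒∣ p∣α)

admissible⇒power-of-two-discriminator : ∀ {α β} → Admissible α β → ∀ γ →
  HasPowerOfTwoDiscriminator (λ k → quad α β γ (+ k))
admissible⇒power-of-two-discriminator adm γ n _ =
  ℕ.m^n>0 2 ⌈log₂ n ⌉ , admissible⇒incongruent adm γ n ,
  λ m 1≤m → admissible⇒least adm γ m 1≤m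

theorem8 : (α β γ : ℤ) →
    (∀ (n : ℕ) → 1 ≤ n → IsDiscriminator (λ k → quad α β γ (+ k)) n (2 ^ ⌈log₂ n ⌉)) →
    ∀ (c : ℤ) (n : ℕ) → 1 ≤ n →
    IsDiscriminator (λ k → quad α β γ (+ k + c)) n (2 ^ ⌈log₂ n ⌉)
theorem8 α β γ disc c n 1≤n =
  IsDiscriminator-cong (λ k → sym (quad-shift α β γ c (+ k)))
    (admissible⇒power-of-two-discriminator shifted (quad α β γ c) n 1≤n)
  where
  shifted : Admissible α (α * (c + c) + β)
  shifted = admissible-shift (power-of-two-discriminator⇒admissible disc) c
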